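{- Let $q$ be a prime power, $N\ge 1$, and fix a basis $\{e_1,\dots,e_N\}$ of $\mathbb{F}_q^N$. Let $\mathcal{V}$ and $\mathcal{U}$ be subspaces of $\mathbb{F}_q^N$, with $\boldsymbol{v}=\tau(\mathcal{V})$ and $\boldsymbol{u}=\tau(\mathcal{U})$, and let $\boldsymbol{v}_j$, $\boldsymbol{u}_j$ denote the $j$-th columns of $\boldsymbol{v}$, $\boldsymbol{u}$. Then $\mathcal{V}$ covers $\mathcal{U}$ (i.e. $\mathcal{U}\subset\mathcal{V}$ and $\dim\mathcal{V}=\dim\mathcal{U}+1$) if and only if all of the following hold: (i) the diagonals $(\boldsymbol{v}_{11},\dots,\boldsymbol{v}_{NN})$ and $(\boldsymbol{u}_{11},\dots,\boldsymbol{u}_{NN})$ are at Hamming distance $1$, with the unique differing coordinate $k\in\{1,\dots,N\}$ satisfying $\boldsymbol{v}_{kk}=1$ and $\boldsymbol{u}_{kk}=0$; (ii) $\boldsymbol{v}_j=\boldsymbol{u}_j$ for all $j=1,\dots,k-1$; (iii) there exist $c_j\in\mathbb{F}_q$ such that $\boldsymbol{u}_j=\boldsymbol{v}_j+c_j\boldsymbol{v}_k$ for all $j=k+1,\dots,N$.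
   Context: For a subspace $\mathcal{V}\subseteq\mathbb{F}_q^N$, $\tau(\mathcal{V})$ denotes the unique upper triangular $N\times N$ matrix $\boldsymbol{v}=(\boldsymbol{v}_{ij})$ with entries in $\mathbb{F}_q$ such that: its columns $\boldsymbol{v}_j=\sum_i \boldsymbol{v}_{ij}e_i$ ($j=1,\dots,N$) span $\mathcal{V}$; its diagonal entries satisfy $\boldsymbol{v}_{ii}\in\{0,1\}$; and for $i\neq j$, $\boldsymbol{v}_{ij}\neq 0$ implies $\boldsymbol{v}_{ii}=0$ and $\boldsymbol{v}_{jj}=1$. (Thus a column $\boldsymbol{v}_j$ is zero when $\boldsymbol{v}_{jj}=0$, and when $\boldsymbol{v}_{jj}=1$ the column $\boldsymbol{v}_j$ is the only one with a nonzero entry in row $j$; existence and uniqueness of this matrix follows from Gaussian elimination.) The number of diagonal entries equal to $1$ in $\tau(\mathcal{V})$ equals $\dim\mathcal{V}$. -}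

module Defs where

open import Data.Nat using (ℕ; zero; suc)
open import Data.Fin using (Fin; zero; suc)
open import Data.Product using (Σ; ∃; _×_; _,_)
open import Data.Sum using (_⊎_)
open import Relation.Nullary using (¬_)
open import Relation.Binary.PropositionalEquality using (_≡_)
open import Algebra.Structures using (IsCommutativeRing)
open import Function.Bundles using (_↔_; _⇔_)

record Field : Set₁ where
  infixl 6 _+_
  infixl 7 _*_
  field
    Carrier : Set
    _+_ _*_ : Carrier → Carrier → Carrier
    -_ : Carrier → Carrier
    0# 1# : Carrier
    isCommutativeRing : IsCommutativeRing _≡_ _+_ _*_ -_ 0# 1#
    0≢1 : ¬ (0# ≡ 1#)
    inverse : ∀ x → ¬ (x ≡ 0#) → ∃ λ y → x * y ≡ 1#

-- A finite field F_q: a field whose carrier is in bijection with Fin q.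
-- (Every finite field has prime-power order q, and every such field is F_q.)
record FiniteField : Set₁ where
  field
    field′ : Field
    q : ℕ
    enum : Field.Carrier field′ ↔ Fin q
  open Field field′ public

module LinAlg (F : Field) where
  open Field F

  -- vectors of F^N, in coordinates w.r.t. the fixed basis e_1..e_N
  Vector : ℕ → Set
  Vector N = Fin N → Carrier

  -- N×N matrices: M i j = entry in row i, column j
  Matrix : ℕ → Set
  Matrix N = Fin N → Fin N → Carrier

  _≐_ : ∀ {N} → Vector N → Vector N → Set
  v ≐ w = ∀ i → v i ≡ w i

  sumF : ∀ {n} → (Fin n → Carrier) → Carrier
  sumF {zero}  f = 0#
  sumF {suc n} f = f zero + sumF (λ i → f (suc i))

  lincomb : ∀ {N d} → (Fin d → Carrier) → (Fin d → Vector N) → Vector N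
  lincomb c b i = sumF (λ j → c j * b j i)

  InSpan : ∀ {N d} → (Fin d → Vector N) → Vector N → Set
  InSpan b w = ∃ λ c → w ≐ lincomb c b

  record Subspace (N : ℕ) : Set₁ where
    field
      _∈V : Vector N → Set
      resp : ∀ {v w} → v ≐ w → v ∈V → w ∈V
      zero∈ : (λ _ → 0#) ∈V
      +∈ : ∀ {v w} → v ∈V → w ∈V → (λ i → v i + w i) ∈V
      *∈ : ∀ a {v} → v ∈V → (λ i → a * v i) ∈V

  open Subspace public

  _⊆_ : ∀ {N} → Subspace N → Subspace N → Set
  U ⊆ V = ∀ w → _∈V U w → _∈V V w

  LinIndep : ∀ {N d} → (Fin d → Vector N) → Set
  LinIndep b = ∀ c → lincomb c b ≐ (λ _ → 0#) → ∀ j → c j ≡ 0#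

  HasDim : ∀ {N} → Subspace N → ℕ → Set
  HasDim {N} V d = Σ (Fin d → Vector N) λ b →
    (∀ j → _∈V V (b j)) × LinIndep b × (∀ w → _∈V V w → InSpan b w)

  Covers : ∀ {N} → Subspace N → Subspace N → Set
  Covers V U = (U ⊆ V) × ∃ λ d → HasDim U d × HasDim V (suc d)

  column : ∀ {N} → Matrix N → Fin N → Vector N
  column M j i = M i j

  record IsTau {N} (V : Subspace N) (M : Matrix N) : Set where
    field
      upper : ∀ i j → j Data.Fin.< i → M i j ≡ 0#
      spans : ∀ w → (_∈V V w ⇔ InSpan (column M) w)
      diag01 : ∀ i → (M i i ≡ 0#) ⊎ (M i i ≡ 1#)
      offdiag : ∀ i j → ¬ (i ≡ j) → ¬ (M i j ≡ 0#) → (M i i ≡ 0#) × (M j j ≡ 1#)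

  Conditions : ∀ {N} → Matrix N → Matrix N → Set
  Conditions {N} v u = ∃ λ (k : Fin N) →
      ((v k k ≡ 1#) × (u k k ≡ 0#) × (∀ i → ¬ (i ≡ k) → v i i ≡ u i i))
    × (∀ j → j Data.Fin.< k → column v j ≐ column u j)
    × (∃ λ (c : Fin N → Carrier) → ∀ j → k Data.Fin.< j →
          column u j ≐ (λ i → v i j + c j * v i k))

-- Reading off the pivots: the columns of τ(V) with diagonal entry 1 form a basis of V, so
-- dim V is the number of 1s on the diagonal of τ(V), and a vector of V is determined by its
-- coordinates at these pivots. If U ⊆ V, every pivot of U is a pivot of V (the last nonzero
-- coordinate of a vector of V sits at a pivot of V), so when V covers U the pivots of V are
-- those of U together with a single new one k. Comparing the columns of τ(U) with the vectors
-- v_j + u_kj v_k of V at the pivots of V gives u_j = v_j + u_kj v_k for every j ≠ k, and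
-- u_kj = 0 for j < k by triangularity. Conversely, (i)–(iii) put every column of τ(U) in V
-- and make the pivot counts differ by one.
module Submission where

open import Defs
open import Data.Nat using (ℕ; _≤_)
open import Function.Bundles using (_⇔_)

open import Algebra.Bundles using (CommutativeMonoid; CommutativeRing)
open import Algebra.Structures using (IsCommutativeRing)
import Algebra.Properties.CommutativeMonoid.Sum as MonoidSum
import Algebra.Properties.CommutativeSemigroup as CommutativeSemigroupProperties
import Algebra.Properties.Ring as RingProperties
import Algebra.Properties.Semiring.Sum as SemiringSum
open import Data.Bool using (Bool; true; false; if_then_else_)
open import Data.Fin as Fin using (Fin; zero; suc; punchIn)
open import Data.Fin.Properties as Finₚ using (suc-injective; punchInᵢ≢i; all?; ¬∀⟶∃¬; inj⇒≟)
open import Data.Nat as ℕ using (zero; suc; z≤n; s≤s)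
open import Data.Nat.Properties as ℕₚ using (m≤n⇒m≤1+n; ≤-antisym; _≤?_; ≰⇒>; n≮n)
open import Data.Product using (∃; _×_; _,_; proj₁; proj₂)
open import Data.Sum using (_⊎_; inj₁; inj₂)
open import Data.Vec.Functional using (insertAt; removeAt)
open import Data.Vec.Functional.Properties using (insertAt-lookup; insertAt-punchIn)
open import Function using (_∘_)
open import Function.Bundles using (Equivalence; mk⇔)
open import Function.Properties.Inverse using (↔⇒↣)
open import Relation.Binary using (tri<; tri≈; tri>)
open import Relation.Binary.Definitions using (DecidableEquality)
open import Relation.Binary.PropositionalEquality
  using (_≡_; _≢_; refl; sym; trans; cong; cong₂; subst; _≗_; module ≡-Reasoning)
open import Relation.Nullary using (yes; no; does)
open import Relation.Nullary.Decidable using (dec-true; dec-false; decidable-stable)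
open import Relation.Nullary.Negation using (contradiction)

count : ∀ {n} → (Fin n → Bool) → ℕ
count {zero}  P = 0
count {suc n} P = if P zero then suc (count (P ∘ suc)) else count (P ∘ suc)

enumerate : ∀ {n} (P : Fin n → Bool) → Fin (count P) → Fin n
enumerate {suc n} P i with P zero
... | true with i
...   | zero  = zero
...   | suc j = suc (enumerate (P ∘ suc) j)
enumerate {suc n} P i | false = suc (enumerate (P ∘ suc) i)

enumerate-true : ∀ {n} (P : Fin n → Bool) i → P (enumerate P i) ≡ true
enumerate-true {suc n} P i with P zero in p
... | true with i
...   | zero  = p
...   | suc j = enumerate-true (P ∘ suc) j
enumerate-true {suc n} P i | false = enumerate-true (P ∘ suc) i

enumerate-injective : ∀ {n} (P : Fin n → Bool) {i j} → enumerate P i ≡ enumerate P j → i ≡ j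
enumerate-injective {suc n} P {i} {j} eq with P zero
... | true with i | j
...   | zero  | zero  = refl
...   | suc i | suc j = cong suc (enumerate-injective (P ∘ suc) (suc-injective eq))
enumerate-injective {suc n} P eq | false = enumerate-injective (P ∘ suc) (suc-injective eq)

_⊆ᵇ_ : ∀ {n} → (Fin n → Bool) → (Fin n → Bool) → Set
P ⊆ᵇ Q = ∀ i → P i ≡ true → Q i ≡ true

Adjoins : ∀ {n} → (Fin n → Bool) → Fin n → (Fin n → Bool) → Set
Adjoins P k Q = Q k ≡ true × P k ≡ false × (∀ i → i ≢ k → Q i ≡ P i)

count-cong : ∀ {n} {P Q : Fin n → Bool} → P ≗ Q → count P ≡ count Q
count-cong {zero}          P≗Q = refl
count-cong {suc n} {P} {Q} P≗Q rewrite P≗Q zero with Q zero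
... | true  = cong suc (count-cong (P≗Q ∘ suc))
... | false = count-cong (P≗Q ∘ suc)

count-mono : ∀ {n} {P Q : Fin n → Bool} → P ⊆ᵇ Q → count P ≤ count Q
count-mono {zero}          P⊆Q = z≤n
count-mono {suc n} {P} {Q} P⊆Q with P zero in p | Q zero in q
... | true  | true  = s≤s (count-mono (P⊆Q ∘ suc))
... | true  | false = contradiction (trans (sym (P⊆Q zero p)) q) λ ()
... | false | true  = m≤n⇒m≤1+n (count-mono (P⊆Q ∘ suc))
... | false | false = count-mono (P⊆Q ∘ suc)

⊆ᵇ∧count≡⇒≗ : ∀ {n} {P Q : Fin n → Bool} → P ⊆ᵇ Q → count Q ≡ count P → Q ≗ P
⊆ᵇ∧count≡⇒≗ {suc n} {P} {Q} P⊆Q eq i with P zero in p | Q zero in q | i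
... | true  | true  | zero  = trans q (sym p)
... | true  | true  | suc i = ⊆ᵇ∧count≡⇒≗ (P⊆Q ∘ suc) (ℕₚ.suc-injective eq) i
... | true  | false | _     = contradiction (trans (sym (P⊆Q zero p)) q) λ ()
... | false | true  | _     =
  contradiction (subst (_≤ count (Q ∘ suc)) (sym eq) (count-mono (P⊆Q ∘ suc))) (n≮n _)
... | false | false | zero  = trans q (sym p)
... | false | false | suc i = ⊆ᵇ∧count≡⇒≗ (P⊆Q ∘ suc) eq i

count-adjoin : ∀ {n} {P Q : Fin n → Bool} {k} → Adjoins P k Q → count Q ≡ suc (count P)
count-adjoin {suc n} {P} {Q} {zero} (qk , pk , others) rewrite qk | pk =
  cong suc (count-cong λ i → others (suc i) λ ())
count-adjoin {suc n} {P} {Q} {suc k} (qk , pk , others)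
  with count-adjoin {P = P ∘ suc} {Q ∘ suc}
         (qk , pk , λ i i≢k → others (suc i) (i≢k ∘ suc-injective))
... | IH rewrite others zero (λ ()) with P zero
...   | true  = cong suc IH
...   | false = IH

adjoins-suc : ∀ {n} {P Q : Fin (suc n) → Bool} {k} →
              Q zero ≡ P zero → Adjoins (P ∘ suc) k (Q ∘ suc) → Adjoins P (suc k) Q
adjoins-suc q≡p (qk , pk , others) = qk , pk , λ
  { zero    _     → q≡p
  ; (suc i) i≢1+k → others i (i≢1+k ∘ cong suc) }

⊆ᵇ∧count≡suc⇒adjoins : ∀ {n} {P Q : Fin n → Bool} → P ⊆ᵇ Q → count Q ≡ suc (count P) →
                       ∃ λ k → Adjoins P k Q
⊆ᵇ∧count≡suc⇒adjoins {suc n} {P} {Q} P⊆Q eq with P zero in p | Q zero in q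
... | true  | true  with ⊆ᵇ∧count≡suc⇒adjoins (P⊆Q ∘ suc) (ℕₚ.suc-injective eq)
...   | k , adj = suc k , adjoins-suc (trans q (sym p)) adj
⊆ᵇ∧count≡suc⇒adjoins P⊆Q eq | true  | false = contradiction (trans (sym (P⊆Q zero p)) q) λ ()
⊆ᵇ∧count≡suc⇒adjoins P⊆Q eq | false | true  = zero , q , p , λ
  { zero    0≢0 → contradiction refl 0≢0
  ; (suc i) _   → ⊆ᵇ∧count≡⇒≗ (P⊆Q ∘ suc) (ℕₚ.suc-injective eq) i }
⊆ᵇ∧count≡suc⇒adjoins P⊆Q eq | false | false with ⊆ᵇ∧count≡suc⇒adjoins (P⊆Q ∘ suc) eq
...   | k , adj = suc k , adjoins-suc (trans q (sym p)) adj

module CommutativeMonoidSums {c ℓ} (M : CommutativeMonoid c ℓ) where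
  open CommutativeMonoid M
    using (Carrier; _≈_; setoid; ∙-cong; ∙-congˡ; identityˡ; identityʳ)
    renaming (_∙_ to _+_; ε to 0#; refl to ≈-refl; trans to ≈-trans)
  open MonoidSum M using (sum; sum-remove)
  open import Relation.Binary.Reasoning.Setoid setoid

  sum-zero : ∀ {n} {f : Fin n → Carrier} → (∀ i → f i ≈ 0#) → sum f ≈ 0#
  sum-zero {zero}  f≈0 = ≈-refl
  sum-zero {suc n} f≈0 = ≈-trans (∙-cong (f≈0 zero) (sum-zero (f≈0 ∘ suc))) (identityˡ 0#)

  sum-single : ∀ {n} (f : Fin n → Carrier) k → (∀ i → i ≢ k → f i ≈ 0#) → sum f ≈ f k
  sum-single {suc n} f k f≈0 = begin
    sum f                     ≈⟨ sum-remove {i = k} f ⟩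
    f k + sum (removeAt f k)  ≈⟨ ∙-congˡ (sum-zero λ j → f≈0 (punchIn k j) (punchInᵢ≢i k j)) ⟩
    f k + 0#                  ≈⟨ identityʳ (f k) ⟩
    f k                       ∎

  sum-enumerate : ∀ {n} (P : Fin n → Bool) (f : Fin n → Carrier) →
                  (∀ i → P i ≡ false → f i ≈ 0#) → sum f ≈ sum (f ∘ enumerate P)
  sum-enumerate {zero}  P f f≈0 = ≈-refl
  sum-enumerate {suc n} P f f≈0 with P zero in p
  ... | true  = ∙-congˡ (sum-enumerate (P ∘ suc) (f ∘ suc) (f≈0 ∘ suc))
  ... | false = ≈-trans (∙-cong (f≈0 zero p) (sum-enumerate (P ∘ suc) (f ∘ suc) (f≈0 ∘ suc)))
                      (identityˡ _)

module LinearAlgebra (F : Field) (_≟_ : DecidableEquality (Field.Carrier F)) where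
  open Field F
  open LinAlg F
  open IsCommutativeRing isCommutativeRing
    using ( +-identityˡ; +-identityʳ; -‿inverseˡ; -‿inverseʳ
          ; *-assoc; *-comm; *-identityˡ; *-identityʳ; distribˡ; zeroˡ; zeroʳ )
  open ≡-Reasoning

  commutativeRing : CommutativeRing _ _
  commutativeRing = record { isCommutativeRing = isCommutativeRing }

  open CommutativeRing commutativeRing
    using (ring; semiring; +-commutativeMonoid; *-commutativeSemigroup)
  open SemiringSum semiring
    using (sum; sum-cong-≗; sum-remove; ∑-distrib-+; ∑-comm; *-distribˡ-sum; *-distribʳ-sum)
  open CommutativeMonoidSums +-commutativeMonoid using (sum-zero; sum-single; sum-enumerate)
  open RingProperties ring using (-‿distribˡ-*)
  open CommutativeSemigroupProperties *-commutativeSemigroup using (x∙yz≈y∙xz)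

  sumF≡sum : ∀ {n} (f : Fin n → Carrier) → sumF f ≡ sum f
  sumF≡sum {zero}  f = refl
  sumF≡sum {suc n} f = cong (f zero +_) (sumF≡sum (f ∘ suc))

  infix 7 _·_
  _·_ : ∀ {m} → Vector m → Vector m → Carrier
  x · ρ = sum λ i → x i * ρ i

  ·-insertAt : ∀ {m} (y : Vector m) i s (ρ : Vector (suc m)) →
               insertAt y i s · ρ ≡ s * ρ i + y · removeAt ρ i
  ·-insertAt y i s ρ = begin
    insertAt y i s · ρ
      ≡⟨ sum-remove {i = i} (λ j → insertAt y i s j * ρ j) ⟩
    insertAt y i s i * ρ i + sum (λ j → insertAt y i s (punchIn i j) * ρ (punchIn i j))
      ≡⟨ cong₂ _+_ (cong (_* ρ i) (insertAt-lookup y i s))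
                   (sum-cong-≗ λ j → cong (_* ρ (punchIn i j)) (insertAt-punchIn y i s j)) ⟩
    s * ρ i + y · removeAt ρ i
      ∎

  ·-combination : ∀ {m} (x σ ρ : Vector m) k → x · (λ i → σ i + k * ρ i) ≡ x · σ + k * (x · ρ)
  ·-combination x σ ρ k = begin
    x · (λ i → σ i + k * ρ i)
      ≡⟨ sum-cong-≗ termwise ⟩
    sum (λ i → x i * σ i + k * (x i * ρ i))
      ≡⟨ ∑-distrib-+ (λ i → x i * σ i) _ ⟩
    x · σ + sum (λ i → k * (x i * ρ i))
      ≡⟨ cong (x · σ +_) (sym (*-distribˡ-sum k (λ i → x i * ρ i))) ⟩
    x · σ + k * (x · ρ)
      ∎
    where
    termwise : ∀ i → x i * (σ i + k * ρ i) ≡ x i * σ i + k * (x i * ρ i)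
    termwise i = trans (distribˡ (x i) _ _) (cong (x i * σ i +_) (x∙yz≈y∙xz (x i) k (ρ i)))

  -- Homogeneous systems and dimension

  module PivotElimination {n m} (A : Fin (suc n) → Vector (suc m)) (p : Fin (suc m))
                          (a≢0 : A zero p ≢ 0#) where
    a a⁻¹ : Carrier
    a = A zero p
    a⁻¹ = proj₁ (inverse a a≢0)

    -[b/a]*a≡-b : ∀ b → - (b * a⁻¹) * a ≡ - b
    -[b/a]*a≡-b b = begin
      - (b * a⁻¹) * a    ≡⟨ sym (-‿distribˡ-* _ a) ⟩
      - (b * a⁻¹ * a)    ≡⟨ cong -_ (*-assoc b a⁻¹ a) ⟩
      - (b * (a⁻¹ * a))  ≡⟨ cong (λ z → - (b * z)) (trans (*-comm a⁻¹ a) (proj₂ (inverse a a≢0))) ⟩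
      - (b * 1#)         ≡⟨ cong -_ (*-identityʳ b) ⟩
      - b                ∎

    reduce : Vector (suc m) → Vector (suc m)
    reduce ρ i = ρ i + - (ρ p * a⁻¹) * A zero i

    reduce-pivot : ∀ ρ → reduce ρ p ≡ 0#
    reduce-pivot ρ = trans (cong (ρ p +_) (-[b/a]*a≡-b (ρ p))) (-‿inverseʳ (ρ p))

    reduced : Fin n → Vector m
    reduced l = removeAt (reduce (A (suc l))) p

    -- The new coordinate x_p is the one making the first equation hold; the other equations
    -- then follow because reduce ρ = ρ − (ρ_p / a) A₀.
    extend : Vector m → Vector (suc m)
    extend y = insertAt y p (- ((y · removeAt (A zero) p) * a⁻¹))

    extend-solution : ∀ y → (∀ l → y · reduced l ≡ 0#) → ∀ l → extend y · A l ≡ 0#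
    extend-solution y y·R = x·A
      where
      S = y · removeAt (A zero) p
      s = - (S * a⁻¹)
      x = extend y

      x·A₀ : x · A zero ≡ 0#
      x·A₀ = trans (·-insertAt y p s (A zero))
                   (trans (cong (_+ S) (-[b/a]*a≡-b S)) (-‿inverseˡ S))

      x·A : ∀ l → x · A l ≡ 0#
      x·A zero    = x·A₀
      x·A (suc l) = begin
        x · ρ                                ≡⟨ sym (+-identityʳ _) ⟩
        x · ρ + 0#                           ≡⟨ cong (x · ρ +_) (sym (zeroʳ _)) ⟩
        x · ρ + - (ρ p * a⁻¹) * 0#           ≡⟨ cong (λ z → x · ρ + - (ρ p * a⁻¹) * z) (sym x·A₀) ⟩
        x · ρ + - (ρ p * a⁻¹) * (x · A zero) ≡⟨ sym (·-combination x ρ (A zero) _) ⟩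
        x · reduce ρ                         ≡⟨ ·-insertAt y p s (reduce ρ) ⟩
        s * reduce ρ p + y · reduced l       ≡⟨ cong₂ _+_ (cong (s *_) (reduce-pivot ρ)) (y·R l) ⟩
        s * 0# + 0#                          ≡⟨ trans (+-identityʳ _) (zeroʳ s) ⟩
        0#                                   ∎
        where ρ = A (suc l)

  open PivotElimination using (reduced; extend; extend-solution)

  homogeneous-nontrivial : ∀ {n m} → n ℕ.< m → (A : Fin n → Vector m) →
                           ∃ λ x → (∃ λ j → x j ≢ 0#) × (∀ l → x · A l ≡ 0#)
  homogeneous-nontrivial {zero} {suc m} _ A = (λ _ → 1#) , (zero , 0≢1 ∘ sym) , λ ()
  homogeneous-nontrivial {suc n} {suc m} (s≤s n<m) A with all? (λ i → A zero i ≟ 0#)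
  ... | yes A₀≡0 with homogeneous-nontrivial (m≤n⇒m≤1+n n<m) (A ∘ suc)
  ...   | x , x≢0 , x·A = x , x≢0 , λ
          { zero    → sum-zero λ i → trans (cong (x i *_) (A₀≡0 i)) (zeroʳ _)
          ; (suc l) → x·A l }
  homogeneous-nontrivial {suc n} {suc m} (s≤s n<m) A | no A₀≢0
    with ¬∀⟶∃¬ _ _ (λ i → A zero i ≟ 0#) A₀≢0
  ... | p , a≢0 with homogeneous-nontrivial n<m (reduced A p a≢0)
  ...   | y , (j , yj≢0) , y·R =
          extend A p a≢0 y , (punchIn p j , yj≢0 ∘ trans (sym (insertAt-punchIn y p _ j))) ,
          extend-solution A p a≢0 y y·R

  lincomb≡sum : ∀ {N d} (c : Fin d → Carrier) (b : Fin d → Vector N) t →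
                lincomb c b t ≡ sum (λ j → c j * b j t)
  lincomb≡sum c b t = sumF≡sum (λ j → c j * b j t)

  independent-in-span⇒≤ : ∀ {N m n} (b : Fin m → Vector N) (a : Fin n → Vector N) →
                          LinIndep b → (∀ i → InSpan a (b i)) → m ℕ.≤ n
  independent-in-span⇒≤ {N} {m} {n} b a b-indep b∈⟨a⟩ with m ≤? n
  ... | yes m≤n = m≤n
  ... | no m≰n with homogeneous-nontrivial (≰⇒> m≰n) (λ l i → proj₁ (b∈⟨a⟩ i) l)
  ...   | x , (j , xj≢0) , x·C = contradiction (b-indep x lincomb≡0 j) xj≢0
    where
    C : Fin m → Fin n → Carrier
    C i = proj₁ (b∈⟨a⟩ i)

    b≡Ca : ∀ i t → b i t ≡ sum (λ l → C i l * a l t)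
    b≡Ca i t = trans (proj₂ (b∈⟨a⟩ i) t) (lincomb≡sum (C i) a t)

    lincomb≡0 : lincomb x b ≐ (λ _ → 0#)
    lincomb≡0 t = begin
      lincomb x b t
        ≡⟨ lincomb≡sum x b t ⟩
      sum (λ i → x i * b i t)
        ≡⟨ sum-cong-≗ (λ i → cong (x i *_) (b≡Ca i t)) ⟩
      sum (λ i → x i * sum (λ l → C i l * a l t))
        ≡⟨ sum-cong-≗ (λ i → *-distribˡ-sum (x i) (λ l → C i l * a l t)) ⟩
      sum (λ i → sum (λ l → x i * (C i l * a l t)))
        ≡⟨ ∑-comm (λ i l → x i * (C i l * a l t)) ⟩
      sum (λ l → sum (λ i → x i * (C i l * a l t)))
        ≡⟨ sum-cong-≗ (λ l → sum-cong-≗ λ i → sym (*-assoc (x i) (C i l) (a l t))) ⟩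
      sum (λ l → sum (λ i → x i * C i l * a l t))
        ≡⟨ sum-cong-≗ (λ l → sym (*-distribʳ-sum (a l t) (λ i → x i * C i l))) ⟩
      sum (λ l → (x · λ i → C i l) * a l t)
        ≡⟨ sum-zero (λ l → trans (cong (_* a l t) (x·C l)) (zeroˡ _)) ⟩
      0# ∎

  lincomb∈ : ∀ {N d} (V : Subspace N) (c : Fin d → Carrier) (b : Fin d → Vector N) →
             (∀ j → _∈V V (b j)) → _∈V V (lincomb c b)
  lincomb∈ {d = zero}  V c b b∈V = zero∈ V
  lincomb∈ {d = suc d} V c b b∈V =
    +∈ V (*∈ V (c zero) (b∈V zero)) (lincomb∈ V (c ∘ suc) (b ∘ suc) (b∈V ∘ suc))

  unit : ∀ {d} → Fin d → Vector d
  unit j i = if does (i Fin.≟ j) then 1# else 0#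

  lincomb-unit : ∀ {N d} (b : Fin d → Vector N) j → lincomb (unit j) b ≐ b j
  lincomb-unit b j t = begin
    lincomb (unit j) b t           ≡⟨ lincomb≡sum (unit j) b t ⟩
    sum (λ i → unit j i * b i t)   ≡⟨ sum-single _ j off-diagonal ⟩
    unit j j * b j t               ≡⟨ cong (_* b j t) unit-diagonal ⟩
    1# * b j t                     ≡⟨ *-identityˡ _ ⟩
    b j t                          ∎
    where
    off-diagonal : ∀ i → i ≢ j → unit j i * b i t ≡ 0#
    off-diagonal i i≢j rewrite dec-false (i Fin.≟ j) i≢j = zeroˡ _

    unit-diagonal : unit j j ≡ 1#
    unit-diagonal rewrite dec-true (j Fin.≟ j) refl = refl

  bit : ∀ {x} → x ≡ 0# ⊎ x ≡ 1# → Bool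
  bit (inj₁ _) = false
  bit (inj₂ _) = true

  bit-true : ∀ {x} (b : x ≡ 0# ⊎ x ≡ 1#) → bit b ≡ true → x ≡ 1#
  bit-true (inj₂ x≡1) _ = x≡1

  bit-false : ∀ {x} (b : x ≡ 0# ⊎ x ≡ 1#) → bit b ≡ false → x ≡ 0#
  bit-false (inj₁ x≡0) _ = x≡0

  bit-cong : ∀ {x y} (b : x ≡ 0# ⊎ x ≡ 1#) (b′ : y ≡ 0# ⊎ y ≡ 1#) → x ≡ y → bit b ≡ bit b′
  bit-cong (inj₁ _)   (inj₁ _)   _   = refl
  bit-cong (inj₁ x≡0) (inj₂ y≡1) x≡y = contradiction (trans (sym x≡0) (trans x≡y y≡1)) 0≢1
  bit-cong (inj₂ x≡1) (inj₁ y≡0) x≡y = contradiction (trans (sym y≡0) (trans (sym x≡y) x≡1)) 0≢1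
  bit-cong (inj₂ _)   (inj₂ _)   _   = refl

  bit-injective : ∀ {x y} (b : x ≡ 0# ⊎ x ≡ 1#) (b′ : y ≡ 0# ⊎ y ≡ 1#) → bit b ≡ bit b′ → x ≡ y
  bit-injective (inj₁ x≡0) (inj₁ y≡0) _ = trans x≡0 (sym y≡0)
  bit-injective (inj₂ x≡1) (inj₂ y≡1) _ = trans x≡1 (sym y≡1)

  -- Pivots of τ(V)

  module IsTauProperties {N} {V : Subspace N} {M : Matrix N} (τ : IsTau V M) where
    open IsTau τ public

    column-zero : ∀ j → M j j ≡ 0# → ∀ t → M t j ≡ 0#
    column-zero j Mjj≡0 t with t Fin.≟ j
    ... | yes refl = Mjj≡0
    ... | no  t≢j  = decidable-stable (M t j ≟ 0#) λ Mtj≢0 →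
                       0≢1 (trans (sym Mjj≡0) (proj₂ (offdiag t j t≢j Mtj≢0)))

    pivot-row : ∀ l → M l l ≡ 1# → ∀ j → j ≢ l → M l j ≡ 0#
    pivot-row l Mll≡1 j j≢l = decidable-stable (M l j ≟ 0#) λ Mlj≢0 →
                                0≢1 (trans (sym (proj₁ (offdiag l j (j≢l ∘ sym) Mlj≢0))) Mll≡1)

    column∈ : ∀ j → _∈V V (column M j)
    column∈ j = Equivalence.from (spans _) (unit j , λ t → sym (lincomb-unit (column M) j t))

    lincomb-at-pivot : ∀ c l → M l l ≡ 1# → lincomb c (column M) l ≡ c l
    lincomb-at-pivot c l Mll≡1 = begin
      lincomb c (column M) l   ≡⟨ lincomb≡sum c (column M) l ⟩
      sum (λ j → c j * M l j)  ≡⟨ sum-single _ l (λ j j≢l →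
                                    trans (cong (c j *_) (pivot-row l Mll≡1 j j≢l)) (zeroʳ _)) ⟩
      c l * M l l              ≡⟨ cong (c l *_) Mll≡1 ⟩
      c l * 1#                 ≡⟨ *-identityʳ _ ⟩
      c l                      ∎

    -- The diagonal entry M j j ∈ {0, 1} selects the pivot columns: a vector of V is the combination
    -- of the pivot columns with its own pivot coordinates as coefficients.
    expansion : ∀ w → _∈V V w → ∀ t → w t ≡ sum (λ j → (w j * M j j) * M t j)
    expansion w w∈V t = trans (w≐ t) (trans (lincomb≡sum c (column M) t) (sum-cong-≗ coefficient))
      where
      c = proj₁ (Equivalence.to (spans w) w∈V)
      w≐ = proj₂ (Equivalence.to (spans w) w∈V)

      coefficient : ∀ j → c j * M t j ≡ (w j * M j j) * M t j
      coefficient j with diag01 j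
      ... | inj₁ Mjj≡0 rewrite column-zero j Mjj≡0 t = trans (zeroʳ _) (sym (zeroʳ _))
      ... | inj₂ Mjj≡1 = cong (_* M t j) (sym (begin
        w j * M j j             ≡⟨ cong (w j *_) Mjj≡1 ⟩
        w j * 1#                ≡⟨ *-identityʳ _ ⟩
        w j                     ≡⟨ w≐ j ⟩
        lincomb c (column M) j  ≡⟨ lincomb-at-pivot c j Mjj≡1 ⟩
        c j                     ∎))

    zero-below⇒zero-at-nonpivot : ∀ w → _∈V V w → ∀ l → (∀ t → l Fin.< t → w t ≡ 0#) →
                                  M l l ≡ 0# → w l ≡ 0#
    zero-below⇒zero-at-nonpivot w w∈V l w≡0 Mll≡0 = trans (expansion w w∈V l) (sum-zero term)
      where
      term : ∀ j → (w j * M j j) * M l j ≡ 0#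
      term j with Finₚ.<-cmp j l
      ... | tri< j<l _ _    rewrite upper l j j<l = zeroʳ _
      ... | tri≈ _ refl _   rewrite Mll≡0 = trans (cong (_* 0#) (zeroʳ (w j))) (zeroʳ _)
      ... | tri> _ _ l<j    rewrite w≡0 j l<j = trans (cong (_* M l j) (zeroˡ (M j j))) (zeroˡ _)

    ≐-at-pivots⇒≐ : ∀ w y → _∈V V w → _∈V V y → (∀ l → M l l ≡ 1# → w l ≡ y l) → w ≐ y
    ≐-at-pivots⇒≐ w y w∈V y∈V w≡y t =
      trans (expansion w w∈V t) (trans (sum-cong-≗ term) (sym (expansion y y∈V t)))
      where
      term : ∀ j → (w j * M j j) * M t j ≡ (y j * M j j) * M t j
      term j with diag01 j
      ... | inj₁ Mjj≡0 rewrite Mjj≡0 = cong (_* M t j) (trans (zeroʳ (w j)) (sym (zeroʳ (y j))))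
      ... | inj₂ Mjj≡1 rewrite w≡y j Mjj≡1 = refl

    pivot : Fin N → Bool
    pivot j = bit (diag01 j)

    pivot-basis : HasDim V (count pivot)
    pivot-basis = b , column∈ ∘ e , independent , spanning
      where
      e = enumerate pivot
      b : Fin (count pivot) → Vector N
      b i = column M (e i)

      Mee≡1 : ∀ i → M (e i) (e i) ≡ 1#
      Mee≡1 i = bit-true (diag01 (e i)) (enumerate-true pivot i)

      independent : LinIndep b
      independent c lc≡0 i = begin
        c i                             ≡⟨ sym (*-identityʳ _) ⟩
        c i * 1#                        ≡⟨ cong (c i *_) (sym (Mee≡1 i)) ⟩
        c i * M (e i) (e i)             ≡⟨ sym (sum-single _ i off-diagonal) ⟩
        sum (λ j → c j * M (e i) (e j)) ≡⟨ sym (lincomb≡sum c b (e i)) ⟩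
        lincomb c b (e i)               ≡⟨ lc≡0 (e i) ⟩
        0#                              ∎
        where
        off-diagonal : ∀ j → j ≢ i → c j * M (e i) (e j) ≡ 0#
        off-diagonal j j≢i = trans
          (cong (c j *_) (pivot-row (e i) (Mee≡1 i) (e j) (j≢i ∘ enumerate-injective pivot)))
          (zeroʳ _)

      spanning : ∀ w → _∈V V w → InSpan b w
      spanning w w∈V = coefficient , w≐
        where
        coefficient : Fin (count pivot) → Carrier
        coefficient i = w (e i) * M (e i) (e i)

        non-pivot : ∀ t j → pivot j ≡ false → (w j * M j j) * M t j ≡ 0#
        non-pivot t j pj rewrite bit-false (diag01 j) pj =
          trans (cong (_* M t j) (zeroʳ _)) (zeroˡ _)

        w≐ : w ≐ lincomb coefficient b
        w≐ t = begin
          w t                                 ≡⟨ expansion w w∈V t ⟩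
          sum (λ j → (w j * M j j) * M t j)   ≡⟨ sum-enumerate pivot _ (non-pivot t) ⟩
          sum (λ i → coefficient i * b i t)   ≡⟨ sym (lincomb≡sum coefficient b t) ⟩
          lincomb coefficient b t             ∎

    dim≡count-pivot : ∀ {d} → HasDim V d → d ≡ count pivot
    dim≡count-pivot (b , b∈V , b-indep , b-spans) with pivot-basis
    ... | p , p∈V , p-indep , p-spans = ≤-antisym
      (independent-in-span⇒≤ b p b-indep λ i → p-spans (b i) (b∈V i))
      (independent-in-span⇒≤ p b p-indep λ i → b-spans (p i) (p∈V i))

  span⊆ : ∀ {N d} (U V : Subspace N) (b : Fin d → Vector N) →
          (∀ w → _∈V U w → InSpan b w) → (∀ j → _∈V V (b j)) → U ⊆ V
  span⊆ U V b U⊆⟨b⟩ b∈V w w∈U with U⊆⟨b⟩ w w∈U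
  ... | c , w≐ = resp V (sym ∘ w≐) (lincomb∈ V c b b∈V)

  module Covering {N} {V U : Subspace N} {v u : Matrix N} (τV : IsTau V v) (τU : IsTau U u) where
    module Vₚ = IsTauProperties τV
    module Uₚ = IsTauProperties τU

    ⊆⇒pivots⊆ᵇ : U ⊆ V → Uₚ.pivot ⊆ᵇ Vₚ.pivot
    ⊆⇒pivots⊆ᵇ U⊆V i ui-pivot with Vₚ.diag01 i
    ... | inj₂ _     = refl
    ... | inj₁ vii≡0 = contradiction (trans (sym uii≡0) (bit-true (Uₚ.diag01 i) ui-pivot)) 0≢1
      where
      uii≡0 : u i i ≡ 0#
      uii≡0 = Vₚ.zero-below⇒zero-at-nonpivot (column u i) (U⊆V _ (Uₚ.column∈ i)) i
                (λ t i<t → Uₚ.upper t i i<t) vii≡0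

    column-u≐ : ∀ {k} → U ⊆ V → Adjoins Uₚ.pivot k Vₚ.pivot →
                ∀ j → j ≢ k → column u j ≐ (λ i → v i j + u k j * v i k)
    column-u≐ {k} U⊆V (vk-pivot , _ , same-pivots) j j≢k =
      Vₚ.≐-at-pivots⇒≐ _ _ (U⊆V _ (Uₚ.column∈ j))
        (+∈ V (Vₚ.column∈ j) (*∈ V (u k j) (Vₚ.column∈ k))) at-pivot
      where
      vkk≡1 : v k k ≡ 1#
      vkk≡1 = bit-true (Vₚ.diag01 k) vk-pivot

      at-pivot : ∀ l → v l l ≡ 1# → u l j ≡ v l j + u k j * v l k
      at-pivot l vll≡1 with l Fin.≟ k
      ... | yes refl = sym (begin
        v k j + u k j * v k k  ≡⟨ cong₂ (λ x y → x + u k j * y) (Vₚ.pivot-row k vkk≡1 j j≢k) vkk≡1 ⟩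
        0# + u k j * 1#        ≡⟨ trans (+-identityˡ _) (*-identityʳ _) ⟩
        u k j                  ∎)
      ... | no l≢k = begin
        u l j                  ≡⟨ ulj≡vlj ⟩
        v l j                  ≡⟨ sym (+-identityʳ _) ⟩
        v l j + 0#             ≡⟨ cong (v l j +_) (sym (zeroʳ _)) ⟩
        v l j + u k j * 0#     ≡⟨ cong ((v l j +_) ∘ (u k j *_)) (sym vlk≡0) ⟩
        v l j + u k j * v l k  ∎
        where
        vlk≡0 : v l k ≡ 0#
        vlk≡0 = Vₚ.pivot-row l vll≡1 k (l≢k ∘ sym)

        ull≡1 : u l l ≡ 1#
        ull≡1 = trans (bit-injective (Uₚ.diag01 l) (Vₚ.diag01 l) (sym (same-pivots l l≢k)))
                      vll≡1

        ulj≡vlj : u l j ≡ v l j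
        ulj≡vlj with j Fin.≟ l
        ... | yes refl = trans ull≡1 (sym vll≡1)
        ... | no j≢l   = trans (Uₚ.pivot-row l ull≡1 j j≢l) (sym (Vₚ.pivot-row l vll≡1 j j≢l))

    covers⇒conditions : Covers V U → Conditions v u
    covers⇒conditions (U⊆V , d , dimU , dimV)
      with ⊆ᵇ∧count≡suc⇒adjoins (⊆⇒pivots⊆ᵇ U⊆V)
             (trans (sym (Vₚ.dim≡count-pivot dimV)) (cong suc (Uₚ.dim≡count-pivot dimU)))
    ... | k , adj@(vk-pivot , uk-nonpivot , same-pivots) =
      k , (bit-true (Vₚ.diag01 k) vk-pivot , bit-false (Uₚ.diag01 k) uk-nonpivot ,
           λ i i≢k → bit-injective (Vₚ.diag01 i) (Uₚ.diag01 i) (same-pivots i i≢k)) ,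
      (λ j j<k i → sym (begin
        u i j                  ≡⟨ column-u≐ U⊆V adj j (Finₚ.<⇒≢ j<k) i ⟩
        v i j + u k j * v i k  ≡⟨ cong (λ z → v i j + z * v i k) (Uₚ.upper k j j<k) ⟩
        v i j + 0# * v i k     ≡⟨ trans (cong (v i j +_) (zeroˡ _)) (+-identityʳ _) ⟩
        v i j                  ∎)) ,
      (λ j → u k j) , (λ j k<j → column-u≐ U⊆V adj j (Finₚ.<⇒≢ k<j ∘ sym))

    conditions⇒covers : Conditions v u → Covers V U
    conditions⇒covers (k , (vkk≡1 , ukk≡0 , diag≡) , columns< , (c , columns>)) =
      U⊆V , count Uₚ.pivot , Uₚ.pivot-basis ,
      subst (HasDim V) (count-adjoin pivots-adjoin) Vₚ.pivot-basis
      where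
      column-u∈V : ∀ j → _∈V V (column u j)
      column-u∈V j with Finₚ.<-cmp j k
      ... | tri< j<k _ _ = resp V (columns< j j<k) (Vₚ.column∈ j)
      ... | tri≈ _ refl _ = resp V (λ t → sym (Uₚ.column-zero k ukk≡0 t)) (zero∈ V)
      ... | tri> _ _ k<j =
        resp V (sym ∘ columns> j k<j) (+∈ V (Vₚ.column∈ j) (*∈ V (c j) (Vₚ.column∈ k)))

      U⊆V : U ⊆ V
      U⊆V = span⊆ U V (column u) (λ w → Equivalence.to (Uₚ.spans w)) column-u∈V

      pivots-adjoin : Adjoins Uₚ.pivot k Vₚ.pivot
      pivots-adjoin = bit-cong (Vₚ.diag01 k) (inj₂ refl) vkk≡1 ,
                      bit-cong (Uₚ.diag01 k) (inj₁ refl) ukk≡0 ,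
                      λ i i≢k → bit-cong (Vₚ.diag01 i) (Uₚ.diag01 i) (diag≡ i i≢k)

mainTheorem1 : (F : FiniteField) → let open LinAlg (FiniteField.field′ F) in
    (N : ℕ) → 1 ≤ N → (V U : Subspace N) (v u : Matrix N) →
    IsTau V v → IsTau U u →
    (Covers V U ⇔ Conditions v u)
mainTheorem1 F N _ V U v u τV τU = mk⇔ covers⇒conditions conditions⇒covers
  where
  open LinearAlgebra (FiniteField.field′ F) (inj⇒≟ (↔⇒↣ (FiniteField.enum F)))
  open Covering τV τU
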